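{- For each odd positive integer $n \geq 5$, there exist connected graphs $G_1$ and $G_2$ such that $\chi(G_1)=2$, $\chi^{\mathrm{FAT}}(G_1)=n$, $\chi(G_2)=n$, and $\chi^{\mathrm{FAT}}(G_2)=2$.
   Context: All graphs are simple with a finite nonempty vertex set. $\chi(G)$ denotes the chromatic number of $G$. For a vertex $v$ and a set $S\subseteq V(G)$, let $e(v,S)=|S\cap N(v)|$, where $N(v)$ is the set of neighbors of $v$ and $\deg(v)=|N(v)|$. A (not necessarily proper) vertex coloring of $G$ with color classes $V_1,\dots,V_k$ is a Fair And Tolerant (FAT) $k$-coloring if $V_1,\dots,V_k$ are all nonempty, they partition $V(G)$, and there exist real numbers $\alpha,\beta\in[0,1]$ such that for every vertex $v$ and every $i\in\{1,\dots,k\}$: $e(v,V_i)=\alpha\deg(v)$ if $v\notin V_i$, and $e(v,V_i)=\beta\deg(v)$ if $v\in V_i$. The FAT chromatic number $\chi^{\mathrm{FAT}}(G)$ is the maximum $k$ such that $G$ admits a FAT $k$-coloring (a FAT $1$-coloring always exists).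
   Formalization: The parameters α and β of a FAT coloring range over the rationals in [0,1] rather than the reals, also in the maximum defining the FAT chromatic number. -}

module Defs where

open import Data.Nat using (ℕ; zero; suc; _≤_)
open import Data.Fin using (Fin)
import Data.Fin as F
open import Data.Bool using (Bool; true; false)
open import Data.Integer using (+_)
open import Data.Rational using (ℚ; _/_; _*_; 0ℚ; 1ℚ) renaming (_≤_ to _≤ℚ_)
open import Data.Product using (Σ; ∃; _×_; _,_)
open import Relation.Binary.PropositionalEquality using (_≡_; _≢_)
open import Relation.Nullary using (¬_; Dec; does)
open import Data.Fin using (_≟_)

record Graph : Set where
  field
    n      : ℕ
    adj    : Fin (suc n) → Fin (suc n) → Bool
    sym    : ∀ u v → adj u v ≡ adj v u
    irrefl : ∀ v → adj v v ≡ false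

open Graph public

V : Graph → Set
V G = Fin (suc (n G))

Adj : (G : Graph) → V G → V G → Set
Adj G u v = adj G u v ≡ true

∑ : (m : ℕ) → (Fin m → ℕ) → ℕ
∑ zero    f = 0
∑ (suc m) f = f F.zero Data.Nat.+ ∑ m (λ i → f (F.suc i))

ind : Bool → ℕ
ind true  = 1
ind false = 0

deg : (G : Graph) → V G → ℕ
deg G v = ∑ (suc (n G)) (λ u → ind (adj G v u))

eCol : (G : Graph) {k : ℕ} → (V G → Fin k) → V G → Fin k → ℕ
eCol G c v i = ∑ (suc (n G)) (λ u → ind (adj G v u Data.Bool.∧ does (c u ≟ i)))

data Reach (G : Graph) : V G → V G → Set where
  here : ∀ {v} → Reach G v v
  step : ∀ {u w v} → Adj G u w → Reach G w v → Reach G u v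

Connected : Graph → Set
Connected G = ∀ u v → Reach G u v

ProperColoring : Graph → ℕ → Set
ProperColoring G k = Σ (V G → Fin k) λ c → ∀ u v → Adj G u v → c u ≢ c v

ChromaticNumber : Graph → ℕ → Set
ChromaticNumber G k = ProperColoring G k × (∀ j → ProperColoring G j → k ≤ j)

toℚ : ℕ → ℚ
toℚ m = + m / 1

FATColoring : Graph → ℕ → Set
FATColoring G k =
  Σ (V G → Fin k) λ c →
    (∀ i → ∃ λ v → c v ≡ i) ×
    Σ ℚ λ α → Σ ℚ λ β →
      (0ℚ ≤ℚ α) × (α ≤ℚ 1ℚ) × (0ℚ ≤ℚ β) × (β ≤ℚ 1ℚ) ×
      (∀ v i → (c v ≢ i → toℚ (eCol G c v i) ≡ α * toℚ (deg G v))
             × (c v ≡ i → toℚ (eCol G c v i) ≡ β * toℚ (deg G v)))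

FATChromaticNumber : Graph → ℕ → Set
FATChromaticNumber G k = FATColoring G k × (∀ j → FATColoring G j → j ≤ k)

module Submission where

-- G₁ is the crown graph K₂ × Kₙ (Kₙ,ₙ minus a perfect matching) and G₂ is obtained from Kₙ with one
-- pendant vertex by replacing every vertex with two non-adjacent twins.  Colouring the crown by its
-- Kₙ-coordinate is FAT with α = 1/(n-1), β = 0; colouring G₂ by twin index is FAT with α = β = 1/2,
-- since every neighbourhood consists of pairs of twins.
-- For the upper bounds: in a connected graph a FAT k-colouring with k ≥ 2 has α ≠ 0 (otherwise
-- colours never change along edges), so every vertex sees each foreign colour and k ≤ deg v + 1.
-- In G₁ this gives k ≤ n.  In G₂ a twin of the pendant vertex has degree 2, so k ≤ 3, and k = 3
-- would force β = 0, i.e. a proper 3-colouring of a graph containing Kₙ, n ≥ 4.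

open import Defs hiding (sym)
open import Data.Nat using (ℕ; _≤_; _%_)
open import Data.Product using (Σ; _×_)
open import Relation.Binary.PropositionalEquality using (_≡_)

open import Data.Bool using (Bool; true; false; _∧_; not)
open import Data.Bool.Properties using (∧-assoc; ∧-identityʳ; ∧-zeroʳ)
open import Data.Empty using (⊥-elim)
open import Data.Fin as Fin using (Fin; zero; suc; _≟_; _↑ˡ_; _↑ʳ_; combine; remQuot)
open import Data.Fin.Properties using (suc-injective; remQuot-combine; combine-remQuot; injective⇒≤)
import Data.Integer as ℤ
open import Data.Integer.Properties using (+-injective; +◃n≡+n)
open import Data.Nat using (zero; suc; _+_; _*_; z≤n; s≤s; pred)
open import Data.Nat.Coprimality using (1-coprimeTo) renaming (sym to coprime-sym)
open import Data.Nat.Properties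
  using (+-assoc; +-comm; +-identityʳ; *-identityˡ; *-identityʳ; *-zeroʳ; *-distribˡ-+; *-distribʳ-+;
         ≤-trans; ≤-pred; m≤m+n; m≤n+m; +-monoʳ-≤; +-mono-≤; +-cancelˡ-≤;
         1+n≰n; 1+n≢0; n≢0⇒n>0; n≤0⇒n≡0; <⇒≱; ≤∧≢⇒<)
open import Data.Nat.Tactic.RingSolver using (solve-∀)
open import Data.Product using (∃; _,_; proj₁; proj₂; uncurry)
open import Data.Rational as ℚ using (ℚ; mkℚ; 0ℚ; 1ℚ; 1/_; ↥_; *≤*)
import Data.Rational.Properties as ℚ
open import Function using (_∘_)
open import Relation.Binary.PropositionalEquality
  using (_≢_; refl; sym; trans; cong; cong₂; subst; subst₂; module ≡-Reasoning)
open import Relation.Nullary using (¬_; yes; no; does)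
open import Relation.Nullary.Decidable using (dec-true; dec-false)

-- toℚ m in normal form, so that its numerator and its non-zeroness compute.
normalℚ : ℕ → ℚ
normalℚ m = mkℚ (ℤ.+ m) 0 (coprime-sym (1-coprimeTo m))

toℚ≡normalℚ : ∀ m → toℚ m ≡ normalℚ m
toℚ≡normalℚ m = ℚ.normalize-coprime (coprime-sym (1-coprimeTo m))

toℚ-injective : ∀ {a b} → toℚ a ≡ toℚ b → a ≡ b
toℚ-injective {a} {b} eq = +-injective (trans (sym (↥toℚ a)) (trans (cong ↥_ eq) (↥toℚ b)))
  where
  ↥toℚ : ∀ m → ↥ (toℚ m) ≡ ℤ.+ m
  ↥toℚ m rewrite toℚ≡normalℚ m = refl

toℚ-* : ∀ a b → toℚ (a * b) ≡ toℚ a ℚ.* toℚ b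
toℚ-* a b rewrite toℚ≡normalℚ a | toℚ≡normalℚ b = cong (ℚ._/ 1) (sym (+◃n≡+n (a * b)))

p*d≡0⇒p≡0 : ∀ p d → d ≢ 0 → toℚ 0 ≡ p ℚ.* toℚ d → p ≡ 0ℚ
p*d≡0⇒p≡0 p d d≢0 eq with p ℚ.≟ 0ℚ
... | yes p≡0 = p≡0
... | no  p≢0 = ⊥-elim (d≢0 (toℚ-injective (begin
  toℚ d                   ≡⟨ sym (ℚ.*-identityˡ (toℚ d)) ⟩
  1ℚ ℚ.* toℚ d            ≡⟨ cong (ℚ._* toℚ d) (sym (ℚ.*-inverseˡ p)) ⟩
  (1/ p ℚ.* p) ℚ.* toℚ d  ≡⟨ ℚ.*-assoc (1/ p) p (toℚ d) ⟩
  1/ p ℚ.* (p ℚ.* toℚ d)  ≡⟨ cong (1/ p ℚ.*_) (sym eq) ⟩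
  1/ p ℚ.* 0ℚ             ≡⟨ ℚ.*-zeroʳ (1/ p) ⟩
  0ℚ                      ∎)))
  where
  open ≡-Reasoning
  instance _ = ℚ.≢-nonZero p≢0

0*d⇒≡0 : ∀ {e p} d → p ≡ 0ℚ → toℚ e ≡ p ℚ.* toℚ d → e ≡ 0
0*d⇒≡0 d refl eq = toℚ-injective (trans eq (ℚ.*-zeroˡ (toℚ d)))

1/suc : ℕ → ℚ
1/suc k = 1/ normalℚ (suc k)

0≤1/suc : ∀ k → 0ℚ ℚ.≤ 1/suc k
0≤1/suc k = *≤* (ℤ.+≤+ z≤n)

1/suc≤1 : ∀ k → 1/suc k ℚ.≤ 1ℚ
1/suc≤1 k = *≤* (ℤ.+≤+ (s≤s z≤n))

toℚ≡1/suc* : ∀ k e → toℚ e ≡ 1/suc k ℚ.* toℚ (suc k * e)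
toℚ≡1/suc* k e = sym (begin
  1/suc k ℚ.* toℚ (suc k * e)
    ≡⟨ cong (1/suc k ℚ.*_) (toℚ-* (suc k) e) ⟩
  1/suc k ℚ.* (toℚ (suc k) ℚ.* toℚ e)
    ≡⟨ cong (λ x → 1/suc k ℚ.* (x ℚ.* toℚ e)) (toℚ≡normalℚ (suc k)) ⟩
  1/suc k ℚ.* (normalℚ (suc k) ℚ.* toℚ e)
    ≡⟨ sym (ℚ.*-assoc (1/suc k) (normalℚ (suc k)) (toℚ e)) ⟩
  (1/suc k ℚ.* normalℚ (suc k)) ℚ.* toℚ e
    ≡⟨ cong (ℚ._* toℚ e) (ℚ.*-inverseˡ (normalℚ (suc k))) ⟩
  1ℚ ℚ.* toℚ e
    ≡⟨ ℚ.*-identityˡ (toℚ e) ⟩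
  toℚ e ∎)
  where open ≡-Reasoning

∑-cong : ∀ m {f g : Fin m → ℕ} → (∀ i → f i ≡ g i) → ∑ m f ≡ ∑ m g
∑-cong zero    f≗g = refl
∑-cong (suc m) f≗g = cong₂ _+_ (f≗g zero) (∑-cong m (f≗g ∘ suc))

∑-zero : ∀ m → ∑ m (λ _ → 0) ≡ 0
∑-zero zero    = refl
∑-zero (suc m) = ∑-zero m

∑-+ : ∀ m (f g : Fin m → ℕ) → ∑ m (λ i → f i + g i) ≡ ∑ m f + ∑ m g
∑-+ zero    f g = refl
∑-+ (suc m) f g rewrite ∑-+ m (f ∘ suc) (g ∘ suc) = +-+-swap (f zero) (g zero) _ _
  where
  +-+-swap : ∀ a b c d → (a + b) + (c + d) ≡ (a + c) + (b + d)
  +-+-swap = solve-∀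

∑-*ˡ : ∀ m x (f : Fin m → ℕ) → ∑ m (λ i → x * f i) ≡ x * ∑ m f
∑-*ˡ zero    x f = sym (*-zeroʳ x)
∑-*ˡ (suc m) x f = trans (cong ((x * f zero) +_) (∑-*ˡ m x (f ∘ suc))) (sym (*-distribˡ-+ x (f zero) _))

∑-*ʳ : ∀ m x (f : Fin m → ℕ) → ∑ m (λ i → f i * x) ≡ ∑ m f * x
∑-*ʳ zero    x f = refl
∑-*ʳ (suc m) x f = trans (cong ((f zero * x) +_) (∑-*ʳ m x (f ∘ suc))) (sym (*-distribʳ-+ x (f zero) _))

∑-swap : ∀ m p (g : Fin m → Fin p → ℕ) → ∑ m (λ i → ∑ p (g i)) ≡ ∑ p (λ u → ∑ m (λ i → g i u))
∑-swap zero    p g = sym (∑-zero p)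
∑-swap (suc m) p g rewrite ∑-swap m p (g ∘ suc) = sym (∑-+ p (g zero) _)

∑-single : ∀ m (j : Fin m) (f : Fin m → ℕ) → (∀ i → i ≢ j → f i ≡ 0) → ∑ m f ≡ f j
∑-single (suc m) zero    f f≡0 =
  trans (cong (f zero +_) (trans (∑-cong m (λ i → f≡0 (suc i) λ ())) (∑-zero m))) (+-identityʳ _)
∑-single (suc m) (suc j) f f≡0 =
  trans (cong (_+ ∑ m (f ∘ suc)) (f≡0 zero λ ()))
        (∑-single m j (f ∘ suc) (λ i i≢j → f≡0 (suc i) (i≢j ∘ suc-injective)))

term≤∑ : ∀ m (j : Fin m) (f : Fin m → ℕ) → f j ≤ ∑ m f
term≤∑ (suc m) zero    f = m≤m+n _ _
term≤∑ (suc m) (suc j) f = ≤-trans (term≤∑ m j (f ∘ suc)) (m≤n+m _ _)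

pred+term≤∑ : ∀ m (j : Fin m) (f : Fin m → ℕ) → (∀ i → i ≢ j → 1 ≤ f i) → pred m + f j ≤ ∑ m f
pred+term≤∑ (suc m) zero f pos =
  subst (_≤ ∑ (suc m) f) (+-comm (f zero) m) (+-monoʳ-≤ (f zero) (all-pos m (λ i → pos (suc i) λ ())))
  where
  all-pos : ∀ m {g : Fin m → ℕ} → (∀ i → 1 ≤ g i) → m ≤ ∑ m g
  all-pos zero    pos = z≤n
  all-pos (suc m) pos = +-mono-≤ (pos zero) (all-pos m (pos ∘ suc))
pred+term≤∑ (suc (suc m)) (suc j) f pos =
  +-mono-≤ (pos zero λ ()) (pred+term≤∑ (suc m) j (f ∘ suc) (λ i i≢j → pos (suc i) (i≢j ∘ suc-injective)))

∑-++ : ∀ a b (f : Fin (a + b) → ℕ) → ∑ (a + b) f ≡ ∑ a (λ i → f (i ↑ˡ b)) + ∑ b (λ i → f (a ↑ʳ i))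
∑-++ zero    b f = refl
∑-++ (suc a) b f rewrite ∑-++ a b (f ∘ suc) = sym (+-assoc (f zero) _ _)

∑-combine : ∀ a b (f : Fin (a * b) → ℕ) → ∑ (a * b) f ≡ ∑ a (λ i → ∑ b (λ j → f (combine i j)))
∑-combine zero    b f = refl
∑-combine (suc a) b f =
  trans (∑-++ b (a * b) f) (cong (∑ b (λ j → f (j ↑ˡ (a * b))) +_) (∑-combine a b (λ u → f (b ↑ʳ u))))

∑-remQuot : ∀ a b (f : Fin a × Fin b → ℕ) → ∑ (a * b) (f ∘ remQuot b) ≡ ∑ a (λ i → ∑ b (λ j → f (i , j)))
∑-remQuot a b f =
  trans (∑-combine a b (f ∘ remQuot b)) (∑-cong a (λ i → ∑-cong b (λ j → cong f (remQuot-combine i j))))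

ind-∧ : ∀ a b → ind (a ∧ b) ≡ ind a * ind b
ind-∧ true  b = sym (+-identityʳ (ind b))
ind-∧ false b = refl

∑-ind-∧ : ∀ a b (f : Fin a → Bool) (g : Fin b → Bool) →
          ∑ a (λ i → ∑ b (λ j → ind (f i ∧ g j))) ≡ ∑ a (ind ∘ f) * ∑ b (ind ∘ g)
∑-ind-∧ a b f g = begin
  ∑ a (λ i → ∑ b (λ j → ind (f i ∧ g j)))       ≡⟨ ∑-cong a (λ i → ∑-cong b (λ j → ind-∧ (f i) (g j))) ⟩
  ∑ a (λ i → ∑ b (λ j → ind (f i) * ind (g j))) ≡⟨ ∑-cong a (λ i → ∑-*ˡ b (ind (f i)) (ind ∘ g)) ⟩
  ∑ a (λ i → ind (f i) * ∑ b (ind ∘ g))         ≡⟨ ∑-*ʳ a (∑ b (ind ∘ g)) (ind ∘ f) ⟩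
  ∑ a (ind ∘ f) * ∑ b (ind ∘ g)                 ∎
  where open ≡-Reasoning

∑-pick : ∀ m (t : Fin m) (f : Fin m → Bool) → ∑ m (λ i → ind (f i ∧ does (i ≟ t))) ≡ ind (f t)
∑-pick m t f = begin
  ∑ m (λ i → ind (f i ∧ does (i ≟ t))) ≡⟨ ∑-single m t _ off-t ⟩
  ind (f t ∧ does (t ≟ t))             ≡⟨ cong (λ b → ind (f t ∧ b)) (dec-true (t ≟ t) refl) ⟩
  ind (f t ∧ true)                     ≡⟨ cong ind (∧-identityʳ (f t)) ⟩
  ind (f t)                            ∎
  where
  open ≡-Reasoning
  off-t : ∀ i → i ≢ t → ind (f i ∧ does (i ≟ t)) ≡ 0
  off-t i i≢t rewrite dec-false (i ≟ t) i≢t | ∧-zeroʳ (f i) = refl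

does-≟-sym : ∀ {m} (i j : Fin m) → does (i ≟ j) ≡ does (j ≟ i)
does-≟-sym i j with i ≟ j | j ≟ i
... | yes _   | yes _   = refl
... | no  _   | no  _   = refl
... | yes i≡j | no  j≢i = ⊥-elim (j≢i (sym i≡j))
... | no  i≢j | yes j≡i = ⊥-elim (i≢j (sym j≡i))

_≠ᵇ_ : ∀ {m} → Fin m → Fin m → Bool
i ≠ᵇ j = not (does (i ≟ j))

≠ᵇ-sym : ∀ {m} (i j : Fin m) → i ≠ᵇ j ≡ j ≠ᵇ i
≠ᵇ-sym i j = cong not (does-≟-sym i j)

≠ᵇ-irrefl : ∀ {m} (i : Fin m) → i ≠ᵇ i ≡ false
≠ᵇ-irrefl i rewrite dec-true (i ≟ i) refl = refl

≠ᵇ⇒≢ : ∀ {m} {i j : Fin m} → i ≠ᵇ j ≡ true → i ≢ j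
≠ᵇ⇒≢ {i = i} i≠j refl rewrite ≠ᵇ-irrefl i = false≢true i≠j
  where
  false≢true : false ≢ true
  false≢true ()

≢⇒≠ᵇ : ∀ {m} {i j : Fin m} → i ≢ j → i ≠ᵇ j ≡ true
≢⇒≠ᵇ {i = i} {j} i≢j rewrite dec-false (i ≟ j) i≢j = refl

∑-≠ᵇ : ∀ m (i : Fin m) → ∑ m (λ j → ind (i ≠ᵇ j)) ≡ pred m
∑-≠ᵇ (suc m)       zero    = ∑-one m
  where
  ∑-one : ∀ m → ∑ m (λ _ → 1) ≡ m
  ∑-one zero    = refl
  ∑-one (suc m) = cong suc (∑-one m)
∑-≠ᵇ (suc (suc m)) (suc i) = cong suc (∑-≠ᵇ (suc m) i)

∧≡true⇒ˡ : ∀ a {b} → a ∧ b ≡ true → a ≡ true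
∧≡true⇒ˡ true _ = refl

∑-eCol≡deg : ∀ (G : Graph) {k} (c : V G → Fin k) v → ∑ k (eCol G c v) ≡ deg G v
∑-eCol≡deg G {k} c v = begin
  ∑ k (eCol G c v)
    ≡⟨ ∑-swap k (suc (n G)) (λ i u → ind (adj G v u ∧ does (c u ≟ i))) ⟩
  ∑ (suc (n G)) (λ u → ∑ k (λ i → ind (adj G v u ∧ does (c u ≟ i))))
    ≡⟨ ∑-cong (suc (n G)) (λ u → ∑-cong k (λ i → cong (λ b → ind (adj G v u ∧ b)) (does-≟-sym (c u) i))) ⟩
  ∑ (suc (n G)) (λ u → ∑ k (λ i → ind (adj G v u ∧ does (i ≟ c u))))
    ≡⟨ ∑-cong (suc (n G)) (λ u → ∑-pick k (c u) (λ _ → adj G v u)) ⟩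
  deg G v ∎
  where open ≡-Reasoning

adj⇒eCol≢0 : ∀ (G : Graph) {k} (c : V G → Fin k) {v u} → Adj G v u → eCol G c v (c u) ≢ 0
adj⇒eCol≢0 G c {v} {u} v~u e≡0 =
  1+n≰n (subst₂ _≤_ u-counts e≡0 (term≤∑ (suc (n G)) u (λ w → ind (adj G v w ∧ does (c w ≟ c u)))))
  where
  u-counts : ind (adj G v u ∧ does (c u ≟ c u)) ≡ 1
  u-counts = cong ind (cong₂ _∧_ v~u (dec-true (c u ≟ c u) refl))

Reach-trans : ∀ {G u w v} → Reach G u w → Reach G w v → Reach G u v
Reach-trans here         r′ = r′
Reach-trans (step u~w r) r′ = step u~w (Reach-trans r r′)

Reach-sym : ∀ {G u v} → Reach G u v → Reach G v u
Reach-sym     here                         = here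
Reach-sym {G} (step {u} {w} u~w r) = Reach-trans (Reach-sym r) (step (trans (Graph.sym G w u) u~w) here)

connected-via : ∀ (G : Graph) (h : V G) → (∀ u → Reach G u h) → Connected G
connected-via G h to-h u v = Reach-trans (to-h u) (Reach-sym (to-h v))

clique≤colours : ∀ (G : Graph) {m j} (f : Fin m → V G) → (∀ {i l} → i ≢ l → Adj G (f i) (f l)) →
                 ProperColoring G j → m ≤ j
clique≤colours G f clique (c , proper) = injective⇒≤ injective
  where
  injective : ∀ {i l} → c (f i) ≡ c (f l) → i ≡ l
  injective {i} {l} eq with i ≟ l
  ... | yes i≡l = i≡l
  ... | no  i≢l = ⊥-elim (proper (f i) (f l) (clique i≢l) eq)

module FairTolerant (G : Graph) {j : ℕ} (c : V G → Fin j) (α β : ℚ)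
  (cond : ∀ v i → (c v ≢ i → toℚ (eCol G c v i) ≡ α ℚ.* toℚ (deg G v))
                × (c v ≡ i → toℚ (eCol G c v i) ≡ β ℚ.* toℚ (deg G v))) where

  α≡0⇒monochromatic : α ≡ 0ℚ → ∀ {u w} → Reach G u w → c u ≡ c w
  α≡0⇒monochromatic α≡0 here = refl
  α≡0⇒monochromatic α≡0 (step {u} {w} u~w r) with c u ≟ c w
  ... | yes same   = trans same (α≡0⇒monochromatic α≡0 r)
  ... | no  differ = ⊥-elim (adj⇒eCol≢0 G c u~w (0*d⇒≡0 (deg G u) α≡0 (proj₁ (cond u (c w)) differ)))

  connected⇒α≢0 : Connected G → (∀ i → ∃ λ v → c v ≡ i) → 2 ≤ j → α ≢ 0ℚ
  connected⇒α≢0 connected surjective (s≤s (s≤s _)) α≡0 =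
    0≢1 (trans (sym (proj₂ (surjective zero)))
               (trans (α≡0⇒monochromatic α≡0 (connected v₀ v₁)) (proj₂ (surjective (suc zero)))))
    where
    v₀ v₁ : V G
    v₀ = proj₁ (surjective zero)
    v₁ = proj₁ (surjective (suc zero))
    0≢1 : ∀ {k} → Fin.zero {suc k} ≢ suc zero
    0≢1 ()

  sees-other-colours : α ≢ 0ℚ → ∀ v i → deg G v ≢ 0 → c v ≢ i → 1 ≤ eCol G c v i
  sees-other-colours α≢0 v i deg≢0 cv≢i = n≢0⇒n>0 λ e≡0 →
    α≢0 (p*d≡0⇒p≡0 α (deg G v) deg≢0 (trans (cong toℚ (sym e≡0)) (proj₁ (cond v i) cv≢i)))

  degree-bound : α ≢ 0ℚ → ∀ v → deg G v ≢ 0 → pred j + eCol G c v (c v) ≤ deg G v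
  degree-bound α≢0 v deg≢0 = subst (pred j + eCol G c v (c v) ≤_) (∑-eCol≡deg G c v)
    (pred+term≤∑ j (c v) (eCol G c v) (λ i i≢cv → sees-other-colours α≢0 v i deg≢0 (i≢cv ∘ sym)))

  own-colour-unseen⇒proper : ∀ v → deg G v ≢ 0 → eCol G c v (c v) ≡ 0 → ∀ u w → Adj G u w → c u ≢ c w
  own-colour-unseen⇒proper v deg≢0 e≡0 u w u~w cu≡cw =
    adj⇒eCol≢0 G c u~w (subst (λ x → eCol G c u x ≡ 0) cu≡cw u-sees-none)
    where
    β≡0 : β ≡ 0ℚ
    β≡0 = p*d≡0⇒p≡0 β (deg G v) deg≢0
            (subst (λ e → toℚ e ≡ β ℚ.* toℚ (deg G v)) e≡0 (proj₂ (cond v (c v)) refl))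
    u-sees-none : eCol G c u (c u) ≡ 0
    u-sees-none = 0*d⇒≡0 (deg G u) β≡0 (proj₂ (cond u (c u)) refl)

FAT≤suc-deg : ∀ {G j} → Connected G → FATColoring G j → ∀ v → deg G v ≢ 0 → j ≤ suc (deg G v)
FAT≤suc-deg {j = zero}        _ _ _ _ = z≤n
FAT≤suc-deg {j = suc zero}    _ _ _ _ = s≤s z≤n
FAT≤suc-deg {G} {suc (suc j)} connected (c , surjective , α , β , _ , _ , _ , _ , cond) v deg≢0 =
  s≤s (≤-trans (m≤m+n (suc j) _) (degree-bound (connected⇒α≢0 connected surjective (s≤s (s≤s z≤n))) v deg≢0))
  where open FairTolerant G c α β cond

tight-FAT⇒proper : ∀ {G d} → Connected G → FATColoring G (suc (suc d)) →
                   ∀ v → deg G v ≡ suc d → ProperColoring G (suc (suc d))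
tight-FAT⇒proper {G} {d} connected (c , surjective , α , β , _ , _ , _ , _ , cond) v deg≡ =
  c , own-colour-unseen⇒proper v deg≢0 own≡0
  where
  open FairTolerant G c α β cond
  deg≢0 : deg G v ≢ 0
  deg≢0 deg≡0 = 1+n≢0 (trans (sym deg≡) deg≡0)
  bound : suc d + eCol G c v (c v) ≤ suc d + 0
  bound = subst (suc d + eCol G c v (c v) ≤_) (trans deg≡ (sym (+-identityʳ (suc d))))
                (degree-bound (connected⇒α≢0 connected surjective (s≤s (s≤s z≤n))) v deg≢0)
  own≡0 : eCol G c v (c v) ≡ 0
  own≡0 = n≤0⇒n≡0 (+-cancelˡ-≤ (suc d) _ _ bound)

module OnPairs (k : ℕ) (R : Fin 2 × Fin (suc k) → Fin 2 × Fin (suc k) → Bool)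
  (R-sym : ∀ x y → R x y ≡ R y x) (R-irrefl : ∀ x → R x x ≡ false) where

  graph : Graph
  graph = record
    { n      = pred (2 * suc k)
    ; adj    = λ u v → R (remQuot (suc k) u) (remQuot (suc k) v)
    ; sym    = λ u v → R-sym (remQuot (suc k) u) (remQuot (suc k) v)
    ; irrefl = λ v → R-irrefl (remQuot (suc k) v)
    }

  pair : V graph → Fin 2 × Fin (suc k)
  pair = remQuot (suc k)

  vertex : Fin 2 × Fin (suc k) → V graph
  vertex = uncurry combine

  pair-vertex : ∀ x → pair (vertex x) ≡ x
  pair-vertex (s , i) = remQuot-combine s i

  ∑-vertices : ∀ (F : Fin 2 × Fin (suc k) → ℕ) →
               ∑ (suc (n graph)) (F ∘ pair) ≡ ∑ 2 (λ s → ∑ (suc k) (λ i → F (s , i)))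
  ∑-vertices = ∑-remQuot 2 (suc k)

  adj-vertex : ∀ x y → R x y ≡ true → Adj graph (vertex x) (vertex y)
  adj-vertex x y = subst₂ (λ a b → R a b ≡ true) (sym (pair-vertex x)) (sym (pair-vertex y))

  reach-step : ∀ x y {v} → R x y ≡ true → Reach graph (vertex y) v → Reach graph (vertex x) v
  reach-step x y x~y = step {w = vertex y} (adj-vertex x y x~y)

  connected-via-pair : ∀ h → (∀ x → Reach graph (vertex x) (vertex h)) → Connected graph
  connected-via-pair h to-h = connected-via graph (vertex h) λ u →
    subst (λ w → Reach graph w (vertex h)) (combine-remQuot (suc k) u) (to-h (pair u))

crown : ∀ {m} → Fin 2 × Fin m → Fin 2 × Fin m → Bool
crown (s , i) (t , l) = (s ≠ᵇ t) ∧ (i ≠ᵇ l)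

crown-sym : ∀ {m} (x y : Fin 2 × Fin m) → crown x y ≡ crown y x
crown-sym (s , i) (t , l) = cong₂ _∧_ (≠ᵇ-sym s t) (≠ᵇ-sym i l)

crown-irrefl : ∀ {m} (x : Fin 2 × Fin m) → crown x x ≡ false
crown-irrefl (s , i) rewrite ≠ᵇ-irrefl s = refl

module Crown (k : ℕ) where

  m : ℕ
  m = 3 + k

  open OnPairs (suc (suc k)) crown crown-sym crown-irrefl public

  side : V graph → Fin 2
  side = proj₁ ∘ pair

  index : V graph → Fin m
  index = proj₂ ∘ pair

  crown-degree : ∀ x → ∑ 2 (λ t → ∑ m (λ l → ind (crown x (t , l)))) ≡ suc (suc k)
  crown-degree (s , i) = begin
    ∑ 2 (λ t → ∑ m (λ l → ind ((s ≠ᵇ t) ∧ (i ≠ᵇ l)))) ≡⟨ ∑-ind-∧ 2 m (s ≠ᵇ_) (i ≠ᵇ_) ⟩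
    ∑ 2 (λ t → ind (s ≠ᵇ t)) * ∑ m (λ l → ind (i ≠ᵇ l)) ≡⟨ cong₂ _*_ (∑-≠ᵇ 2 s) (∑-≠ᵇ m i) ⟩
    1 * suc (suc k)                                      ≡⟨ *-identityˡ (suc (suc k)) ⟩
    suc (suc k)                                          ∎
    where open ≡-Reasoning

  crown-colour-degree : ∀ x t →
    ∑ 2 (λ s → ∑ m (λ l → ind (crown x (s , l) ∧ does (l ≟ t)))) ≡ ind (proj₂ x ≠ᵇ t)
  crown-colour-degree (s , i) t = begin
    ∑ 2 (λ u → ∑ m (λ l → ind (((s ≠ᵇ u) ∧ (i ≠ᵇ l)) ∧ does (l ≟ t))))
      ≡⟨ ∑-cong 2 (λ u → ∑-cong m (λ l → cong ind (∧-assoc (s ≠ᵇ u) (i ≠ᵇ l) (does (l ≟ t))))) ⟩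
    ∑ 2 (λ u → ∑ m (λ l → ind ((s ≠ᵇ u) ∧ ((i ≠ᵇ l) ∧ does (l ≟ t)))))
      ≡⟨ ∑-ind-∧ 2 m (s ≠ᵇ_) (λ l → (i ≠ᵇ l) ∧ does (l ≟ t)) ⟩
    ∑ 2 (λ u → ind (s ≠ᵇ u)) * ∑ m (λ l → ind ((i ≠ᵇ l) ∧ does (l ≟ t)))
      ≡⟨ cong₂ _*_ (∑-≠ᵇ 2 s) (∑-pick m t (i ≠ᵇ_)) ⟩
    1 * ind (i ≠ᵇ t)
      ≡⟨ *-identityˡ (ind (i ≠ᵇ t)) ⟩
    ind (i ≠ᵇ t) ∎
    where open ≡-Reasoning

  deg-crown : ∀ v → deg graph v ≡ suc (suc k)
  deg-crown v = trans (∑-vertices (λ y → ind (crown (pair v) y))) (crown-degree (pair v))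

  eCol-crown : ∀ v t → eCol graph index v t ≡ ind (index v ≠ᵇ t)
  eCol-crown v t =
    trans (∑-vertices (λ y → ind (crown (pair v) y ∧ does (proj₂ y ≟ t)))) (crown-colour-degree (pair v) t)

  crown-connected : Connected graph
  crown-connected = connected-via-pair (zero , zero) to-hub
    where
    to-hub : ∀ x → Reach graph (vertex x) (vertex (zero , zero))
    to-hub (zero , zero)      = here
    to-hub (zero , suc i)     =
      reach-step (zero , suc i) (suc zero , zero) refl (to-hub (suc zero , zero))
    to-hub (suc zero , zero)  =
      reach-step (suc zero , zero) (zero , suc zero) refl
        (reach-step (zero , suc zero) (suc zero , suc (suc zero)) refl
          (reach-step (suc zero , suc (suc zero)) (zero , zero) refl here))
    to-hub (suc zero , suc i) = reach-step (suc zero , suc i) (zero , zero) refl here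

  crown-FAT : FATColoring graph m
  crown-FAT = index , (λ i → vertex (zero , i) , cong proj₂ (pair-vertex (zero , i)))
            , 1/suc (suc k) , 0ℚ , 0≤1/suc (suc k) , 1/suc≤1 (suc k) , ℚ.≤-refl , *≤* (ℤ.+≤+ z≤n)
            , λ v i → fair v i , tolerant v i
    where
    open ≡-Reasoning
    fair : ∀ v i → index v ≢ i → toℚ (eCol graph index v i) ≡ 1/suc (suc k) ℚ.* toℚ (deg graph v)
    fair v i index≢i = begin
      toℚ (eCol graph index v i)
        ≡⟨ cong toℚ (trans (eCol-crown v i) (cong ind (≢⇒≠ᵇ index≢i))) ⟩
      toℚ 1
        ≡⟨ toℚ≡1/suc* (suc k) 1 ⟩
      1/suc (suc k) ℚ.* toℚ (suc (suc k) * 1)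
        ≡⟨ cong (λ d → 1/suc (suc k) ℚ.* toℚ d) (trans (*-identityʳ _) (sym (deg-crown v))) ⟩
      1/suc (suc k) ℚ.* toℚ (deg graph v) ∎
    tolerant : ∀ v i → index v ≡ i → toℚ (eCol graph index v i) ≡ 0ℚ ℚ.* toℚ (deg graph v)
    tolerant v i refl = begin
      toℚ (eCol graph index v (index v))
        ≡⟨ cong toℚ (trans (eCol-crown v (index v)) (cong ind (≠ᵇ-irrefl (index v)))) ⟩
      toℚ 0
        ≡⟨ sym (ℚ.*-zeroˡ (toℚ (deg graph v))) ⟩
      0ℚ ℚ.* toℚ (deg graph v) ∎

  crown-FAT-max : ∀ j → FATColoring graph j → j ≤ m
  crown-FAT-max j fat = subst (λ d → j ≤ suc d) (deg-crown zero)
    (FAT≤suc-deg crown-connected fat zero (λ deg≡0 → 1+n≢0 (trans (sym (deg-crown zero)) deg≡0)))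

  crown-χ : ChromaticNumber graph 2
  crown-χ = (side , λ u w u~w → ≠ᵇ⇒≢ (∧≡true⇒ˡ (side u ≠ᵇ side w) u~w))
          , λ j → clique≤colours graph (vertex ∘ diagonal) edge
    where
    diagonal : Fin 2 → Fin 2 × Fin m
    diagonal zero       = zero , zero
    diagonal (suc zero) = suc zero , suc zero
    edge : ∀ {s t} → s ≢ t → Adj graph (vertex (diagonal s)) (vertex (diagonal t))
    edge {zero}     {zero}     s≢t = ⊥-elim (s≢t refl)
    edge {zero}     {suc zero} _   = adj-vertex (diagonal zero) (diagonal (suc zero)) refl
    edge {suc zero} {zero}     _   = adj-vertex (diagonal (suc zero)) (diagonal zero) refl
    edge {suc zero} {suc zero} s≢t = ⊥-elim (s≢t refl)

blowUp : ∀ {m} → (Fin m → Fin m → Bool) → Fin 2 × Fin m → Fin 2 × Fin m → Bool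
blowUp H (_ , x) (_ , y) = H x y

module BlowUp (k : ℕ) (H : Fin (suc k) → Fin (suc k) → Bool)
  (H-sym : ∀ x y → H x y ≡ H y x) (H-irrefl : ∀ x → H x x ≡ false) where

  open OnPairs k (blowUp H) (λ (_ , x) (_ , y) → H-sym x y) (λ (_ , x) → H-irrefl x) public

  side : V graph → Fin 2
  side = proj₁ ∘ pair

  H-degree : Fin (suc k) → ℕ
  H-degree x = ∑ (suc k) (λ y → ind (H x y))

  deg-blowUp : ∀ v → deg graph v ≡ 2 * H-degree (proj₂ (pair v))
  deg-blowUp v = ∑-vertices (λ y → ind (blowUp H (pair v) y))

  eCol-blowUp : ∀ v t → eCol graph side v t ≡ H-degree (proj₂ (pair v))
  eCol-blowUp v t = begin
    eCol graph side v t
      ≡⟨ ∑-vertices (λ y → ind (H x (proj₂ y) ∧ does (proj₁ y ≟ t))) ⟩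
    ∑ 2 (λ s → ∑ (suc k) (λ y → ind (H x y ∧ does (s ≟ t))))
      ≡⟨ ∑-swap 2 (suc k) (λ s y → ind (H x y ∧ does (s ≟ t))) ⟩
    ∑ (suc k) (λ y → ∑ 2 (λ s → ind (H x y ∧ does (s ≟ t))))
      ≡⟨ ∑-cong (suc k) (λ y → ∑-pick 2 t (λ _ → H x y)) ⟩
    H-degree x ∎
    where
    open ≡-Reasoning
    x : Fin (suc k)
    x = proj₂ (pair v)

  blowUp-FAT : FATColoring graph 2
  blowUp-FAT = side , (λ s → vertex (s , zero) , cong proj₁ (pair-vertex (s , zero)))
             , 1/suc 1 , 1/suc 1 , 0≤1/suc 1 , 1/suc≤1 1 , 0≤1/suc 1 , 1/suc≤1 1
             , λ v i → (λ _ → half v i) , (λ _ → half v i)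
    where
    half : ∀ v i → toℚ (eCol graph side v i) ≡ 1/suc 1 ℚ.* toℚ (deg graph v)
    half v i = begin
      toℚ (eCol graph side v i)        ≡⟨ cong toℚ (eCol-blowUp v i) ⟩
      toℚ (H-degree x)                 ≡⟨ toℚ≡1/suc* 1 (H-degree x) ⟩
      1/suc 1 ℚ.* toℚ (2 * H-degree x) ≡⟨ cong (λ d → 1/suc 1 ℚ.* toℚ d) (sym (deg-blowUp v)) ⟩
      1/suc 1 ℚ.* toℚ (deg graph v)    ∎
      where
      open ≡-Reasoning
      x : Fin (suc k)
      x = proj₂ (pair v)

pendantClique : ∀ {m} → Fin (suc (suc m)) → Fin (suc (suc m)) → Bool
pendantClique zero    zero    = false
pendantClique zero    (suc l) = does (l ≟ zero)
pendantClique (suc i) zero    = does (i ≟ zero)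
pendantClique (suc i) (suc l) = i ≠ᵇ l

pendantClique-sym : ∀ {m} (x y : Fin (suc (suc m))) → pendantClique x y ≡ pendantClique y x
pendantClique-sym zero    zero    = refl
pendantClique-sym zero    (suc l) = refl
pendantClique-sym (suc i) zero    = refl
pendantClique-sym (suc i) (suc l) = ≠ᵇ-sym i l

pendantClique-irrefl : ∀ {m} (x : Fin (suc (suc m))) → pendantClique x x ≡ false
pendantClique-irrefl zero    = refl
pendantClique-irrefl (suc i) = ≠ᵇ-irrefl i

module PendantClique (q : ℕ) where

  M : ℕ
  M = 4 + q

  open BlowUp M pendantClique pendantClique-sym pendantClique-irrefl public

  pendant hub : Fin 2 × Fin (suc M)
  pendant = zero , zero
  hub     = zero , suc zero

  connected : Connected graph
  connected = connected-via-pair hub to-hub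
    where
    to-hub : ∀ x → Reach graph (vertex x) (vertex hub)
    to-hub (s , zero)            = reach-step (s , zero) hub refl here
    to-hub (zero , suc zero)     = here
    to-hub (suc zero , suc zero) = reach-step (suc zero , suc zero) pendant refl (to-hub pendant)
    to-hub (s , suc (suc i))     = reach-step (s , suc (suc i)) hub refl here

  label : Fin (suc M) → Fin M
  label zero    = suc zero
  label (suc i) = i

  label-proper : ∀ x y → pendantClique x y ≡ true → label x ≢ label y
  label-proper zero          zero          ()
  label-proper zero          (suc zero)    _   ()
  label-proper zero          (suc (suc l)) ()
  label-proper (suc zero)    zero          _   ()
  label-proper (suc (suc i)) zero          ()
  label-proper (suc i)       (suc l)       x~y = ≠ᵇ⇒≢ x~y

  clique-bound : ∀ j → ProperColoring graph j → M ≤ j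
  clique-bound j = clique≤colours graph (λ i → vertex (zero , suc i))
    (λ {i} {l} i≢l → adj-vertex (zero , suc i) (zero , suc l) (≢⇒≠ᵇ i≢l))

  χ-pendantClique : ChromaticNumber graph M
  χ-pendantClique = (label ∘ proj₂ ∘ pair , λ u w → label-proper (proj₂ (pair u)) (proj₂ (pair w)))
                  , clique-bound

  deg-pendant : deg graph (vertex pendant) ≡ 2
  deg-pendant = begin
    deg graph (vertex pendant)
      ≡⟨ deg-blowUp (vertex pendant) ⟩
    2 * H-degree (proj₂ (pair (vertex pendant)))
      ≡⟨ cong (λ x → 2 * H-degree (proj₂ x)) (pair-vertex pendant) ⟩
    2 * H-degree zero
      ≡⟨ cong (2 *_) (∑-pick M zero (λ _ → true)) ⟩
    2 ∎
    where open ≡-Reasoning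

  no-FAT-3 : ¬ FATColoring graph 3
  no-FAT-3 fat = <⇒≱ (s≤s (s≤s (s≤s (s≤s z≤n))))
    (clique-bound 3 (tight-FAT⇒proper connected fat (vertex pendant) deg-pendant))

  pendantClique-FAT-max : ∀ j → FATColoring graph j → j ≤ 2
  pendantClique-FAT-max j fat = ≤-pred (≤∧≢⇒< j≤3 (λ { refl → no-FAT-3 fat }))
    where
    j≤3 : j ≤ 3
    j≤3 = subst (λ d → j ≤ suc d) deg-pendant
      (FAT≤suc-deg connected fat (vertex pendant) (λ deg≡0 → 1+n≢0 (trans (sym deg-pendant) deg≡0)))

theorem2p3 : (n : ℕ) → 5 ≤ n → n % 2 ≡ 1 →
    Σ Graph λ G₁ → Σ Graph λ G₂ →
      Connected G₁ × Connected G₂ ×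
      ChromaticNumber G₁ 2 × FATChromaticNumber G₁ n ×
      ChromaticNumber G₂ n × FATChromaticNumber G₂ 2
theorem2p3 .(5 + r) (s≤s (s≤s (s≤s (s≤s (s≤s {n = r} _))))) _ =
  G₁.graph , G₂.graph , G₁.crown-connected , G₂.connected ,
  G₁.crown-χ , (G₁.crown-FAT , G₁.crown-FAT-max) ,
  G₂.χ-pendantClique , (G₂.blowUp-FAT , G₂.pendantClique-FAT-max)
  where
  module G₁ = Crown (2 + r)
  module G₂ = PendantClique (1 + r)
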